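{- For every integer $s\ge 2$ there exists a $3$-way (and therefore a $2$-way) $4$-cycle trade of volume $s$ (on a suitable vertex set).
   Context: A $4$-cycle $abcd$ consists of four distinct vertices and edges $\{a,b\},\{b,c\},\{c,d\},\{d,a\}$; $4$-cycles are identified with their edge sets. Two sets $T_1,T_2$ of pairwise edge-disjoint $4$-cycles on the same vertex set form a $4$-cycle bitrade if $T_1\cap T_2=\emptyset$ and $\bigcup_{C\in T_1}E(C)=\bigcup_{C\in T_2}E(C)$; its volume is $|T_1|$. A $\mu$-way $4$-cycle trade of volume $s$ is a collection of $\mu$ pairwise disjoint sets $\{T_1,\dots,T_\mu\}$ of $4$-cycles, each of size $s$, such that $(T_i,T_j)$ is a $4$-cycle bitrade for every $i\neq j$. -}

module Defs where

open import Data.Nat using (ℕ)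
open import Data.Fin using (Fin)
open import Data.Product using (_×_; _,_; ∃-syntax)
open import Data.Sum using (_⊎_)
open import Data.List using (List; []; _∷_; length)
open import Data.List.Relation.Unary.Any using (Any)
open import Data.List.Relation.Unary.AllPairs using (AllPairs)
open import Data.List.Membership.Propositional using (_∈_)
open import Relation.Binary.PropositionalEquality using (_≡_; _≢_)
open import Relation.Nullary using (¬_)
open import Function.Bundles using (_⇔_)

-- An (undirected) edge {x,y} on vertex set Fin n, given by an ordered
-- representative; two representatives denote the same edge iff they
-- agree up to swapping.
Edge : ℕ → Set
Edge n = Fin n × Fin n

SameEdge : ∀ {n} → Edge n → Edge n → Set
SameEdge (x , y) (u , v) = (x ≡ u × y ≡ v) ⊎ (x ≡ v × y ≡ u)

record Cycle4 (n : ℕ) : Set where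
  constructor cyc
  field
    a b c d : Fin n
    a≢b : a ≢ b
    a≢c : a ≢ c
    a≢d : a ≢ d
    b≢c : b ≢ c
    b≢d : b ≢ d
    c≢d : c ≢ d

edges : ∀ {n} → Cycle4 n → List (Edge n)
edges C = (a , b) ∷ (b , c) ∷ (c , d) ∷ (d , a) ∷ []
  where open Cycle4 C

_∈E_ : ∀ {n} → Edge n → Cycle4 n → Set
e ∈E C = Any (SameEdge e) (edges C)

-- 4-cycles are identified with their edge sets.
_≈C_ : ∀ {n} → Cycle4 n → Cycle4 n → Set
C ≈C D = ∀ e → (e ∈E C) ⇔ (e ∈E D)

EdgeDisjoint : ∀ {n} → Cycle4 n → Cycle4 n → Set
EdgeDisjoint C D = ∀ e → e ∈E C → ¬ (e ∈E D)

-- A set of pairwise edge-disjoint 4-cycles, represented as a list whose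
-- entries (at distinct positions) are pairwise edge-disjoint; in particular
-- the entries are pairwise distinct cycles, so the size of the set is the
-- length of the list.
CycleSet : ℕ → Set
CycleSet n = List (Cycle4 n)

PairwiseEdgeDisjoint : ∀ {n} → CycleSet n → Set
PairwiseEdgeDisjoint T = AllPairs EdgeDisjoint T

InUnion : ∀ {n} → Edge n → CycleSet n → Set
InUnion e T = ∃[ C ] (C ∈ T × e ∈E C)

DisjointSets : ∀ {n} → CycleSet n → CycleSet n → Set
DisjointSets T₁ T₂ = ∀ C D → C ∈ T₁ → D ∈ T₂ → ¬ (C ≈C D)

IsBitrade : ∀ {n} → CycleSet n → CycleSet n → Set
IsBitrade T₁ T₂ =
  PairwiseEdgeDisjoint T₁ × PairwiseEdgeDisjoint T₂ ×
  DisjointSets T₁ T₂ ×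
  (∀ e → InUnion e T₁ ⇔ InUnion e T₂)

IsMuWayTrade : ∀ {n} (μ s : ℕ) → (Fin μ → CycleSet n) → Set
IsMuWayTrade μ s T =
  (∀ i → PairwiseEdgeDisjoint (T i)) ×
  (∀ i → length (T i) ≡ s) ×
  (∀ i j → i ≢ j → DisjointSets (T i) (T j)) ×
  (∀ i j → i ≢ j → IsBitrade (T i) (T j))

ExistsMuWayTrade : ℕ → ℕ → Set
ExistsMuWayTrade μ s = ∃[ n ] ∃[ T ] IsMuWayTrade {n} μ s T

-- Suspend a perfect matching M of K_m over two new apexes 0 and 1: every edge {u,v} of M
-- becomes the 4-cycle 0 u 1 v, and these cycles partition the edges of the double star
-- joining both apexes to every old vertex.  Hence μ perfect matchings of K_m, no edge lying
-- in two of them, suspend to a μ-way 4-cycle trade of volume m/2.  Three such matchings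
-- exist for m = 4 (a 1-factorisation of K_4) and m = 6, and vertex-disjoint unions give
-- every volume s = 2 + 2k or s = 3 + 2k.

module Submission where

open import Defs
open import Data.Nat using (ℕ; _≤_; zero; suc; z≤n; s≤s; _+_)
open import Data.Nat.Properties using () renaming (_≟_ to _≟ℕ_)
open import Data.Fin using (Fin; zero; suc; _↑ˡ_; _↑ʳ_; splitAt; join; inject₁; #_)
open import Data.Fin.Properties
  using (_≟_; all?; ↑ˡ-injective; ↑ʳ-injective; splitAt-↑ˡ; splitAt-↑ʳ; join-splitAt; inject₁-injective)
open import Data.Product using (_×_; _,_; ∃-syntax; proj₂)
open import Data.Sum using (_⊎_; inj₁; inj₂; [_,_]′)
import Data.Sum as Sum
import Data.Product as Product
open import Data.Empty using (⊥-elim)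
open import Data.List using (List; []; _∷_; length; map; _++_)
open import Data.List.Properties using (length-map; length-++)
open import Data.List.Relation.Unary.Any using (Any; here; there)
import Data.List.Relation.Unary.Any as Any
import Data.List.Relation.Unary.Any.Properties as Any
open import Data.List.Relation.Unary.All using (All)
import Data.List.Relation.Unary.All as All
import Data.List.Relation.Unary.All.Properties as All
open import Data.List.Relation.Unary.AllPairs using (AllPairs; allPairs?)
import Data.List.Relation.Unary.AllPairs as AllPairs
import Data.List.Relation.Unary.AllPairs.Properties as AllPairs
open import Data.List.Membership.Propositional using (_∈_; find)
open import Data.List.Membership.Propositional.Properties using (∈-map⁺; ∈-map⁻; ∈-++⁻)
open import Relation.Binary.PropositionalEquality using (_≡_; _≢_; refl; sym; trans; cong; cong₂; subst)
open import Relation.Nullary using (¬_; Dec)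
open import Relation.Nullary.Decidable using (toWitness; True; _×-dec_; _⊎-dec_; _→-dec_; ¬?)
open import Function using (_∘_)
open import Function.Bundles using (_⇔_; mk⇔; Equivalence)
open import Function.Construct.Composition using (_⇔-∘_)
open import Function.Construct.Symmetry using (⇔-sym)
open import Function.Definitions using (Injective)

↑ˡ≢↑ʳ : ∀ {m n} (i : Fin m) (j : Fin n) → i ↑ˡ n ≢ m ↑ʳ j
↑ˡ≢↑ʳ {m} {n} i j eq =
  inj₁≢inj₂ (trans (sym (splitAt-↑ˡ m i n)) (trans (cong (splitAt m) eq) (splitAt-↑ʳ m n j)))
  where
  inj₁≢inj₂ : inj₁ i ≢ inj₂ j
  inj₁≢inj₂ ()

SameEdge-sym : ∀ {n} {e f : Edge n} → SameEdge e f → SameEdge f e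
SameEdge-sym (inj₁ (refl , refl)) = inj₁ (refl , refl)
SameEdge-sym (inj₂ (refl , refl)) = inj₂ (refl , refl)

SameEdge-swapʳ : ∀ {n} {e : Edge n} {x y} → SameEdge e (x , y) → SameEdge e (y , x)
SameEdge-swapʳ (inj₁ (p , q)) = inj₂ (p , q)
SameEdge-swapʳ (inj₂ (p , q)) = inj₁ (p , q)

record ProperEdge (m : ℕ) : Set where
  constructor properEdge
  field
    u v : Fin m
    u≢v : u ≢ v

  edge : Edge m
  edge = u , v

open ProperEdge using (edge)

Covers : ∀ {m} → Fin m → ProperEdge m → Set
Covers w (properEdge u v _) = w ≡ u ⊎ w ≡ v

VertexDisjoint : ∀ {m} → ProperEdge m → ProperEdge m → Set
VertexDisjoint p q = ∀ w → Covers w p → ¬ Covers w q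

record MatchingTrade (μ m s : ℕ) : Set where
  field
    matching       : Fin μ → List (ProperEdge m)
    vertexDisjoint : ∀ i → AllPairs VertexDisjoint (matching i)
    perfect        : ∀ i w → Any (Covers w) (matching i)
    size           : ∀ i → length (matching i) ≡ s
    edgeDisjoint   : ∀ {i j} → i ≢ j → ∀ {p q} → p ∈ matching i → q ∈ matching j →
                     ¬ SameEdge (edge p) (edge q)

module Suspension {m : ℕ} where

  apex : Fin 2 → Fin (2 + m)
  apex i = i ↑ˡ m

  base : Fin m → Fin (2 + m)
  base w = 2 ↑ʳ w

  suspend : ProperEdge m → Cycle4 (2 + m)
  suspend (properEdge u v u≢v) =
    cyc (apex zero) (base u) (apex (suc zero)) (base v)
        (λ ()) (λ ()) (λ ()) (λ ()) (u≢v ∘ ↑ʳ-injective 2 u v) (λ ())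

  Spoke : Fin m → Edge (2 + m) → Set
  Spoke w e = ∃[ i ] SameEdge e (apex i , base w)

  spoke-injective : ∀ {w w' e} → Spoke w e → Spoke w' e → w ≡ w'
  spoke-injective (_ , inj₁ (refl , refl)) (_ , inj₁ (_ , eq)) = ↑ʳ-injective 2 _ _ eq
  spoke-injective (_ , inj₁ (refl , refl)) (_ , inj₂ (eq , _)) = ⊥-elim (↑ˡ≢↑ʳ _ _ eq)
  spoke-injective (_ , inj₂ (refl , refl)) (_ , inj₁ (eq , _)) = ⊥-elim (↑ˡ≢↑ʳ _ _ (sym eq))
  spoke-injective (_ , inj₂ (refl , refl)) (_ , inj₂ (eq , _)) = ↑ʳ-injective 2 _ _ eq

  ∈E-suspend⁻ : ∀ p {e} → e ∈E suspend p → ∃[ w ] (Covers w p × Spoke w e)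
  ∈E-suspend⁻ p (here s)                         = _ , inj₁ refl , zero , s
  ∈E-suspend⁻ p (there (here s))                 = _ , inj₁ refl , suc zero , SameEdge-swapʳ s
  ∈E-suspend⁻ p (there (there (here s)))         = _ , inj₂ refl , suc zero , s
  ∈E-suspend⁻ p (there (there (there (here s)))) = _ , inj₂ refl , zero , SameEdge-swapʳ s

  ∈E-suspend⁺ : ∀ p {w e} → Covers w p → Spoke w e → e ∈E suspend p
  ∈E-suspend⁺ p (inj₁ refl) (zero , s)     = here s
  ∈E-suspend⁺ p (inj₁ refl) (suc zero , s) = there (here (SameEdge-swapʳ s))
  ∈E-suspend⁺ p (inj₂ refl) (suc zero , s) = there (there (here s))
  ∈E-suspend⁺ p (inj₂ refl) (zero , s)     = there (there (there (here (SameEdge-swapʳ s))))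

  suspend-edgeDisjoint : ∀ p q → VertexDisjoint p q → EdgeDisjoint (suspend p) (suspend q)
  suspend-edgeDisjoint p q p#q e e∈p e∈q
    with w , w∈p , sp ← ∈E-suspend⁻ p e∈p | w' , w'∈q , sq ← ∈E-suspend⁻ q e∈q
    rewrite spoke-injective sp sq = p#q w' w∈p w'∈q

  spoke-apex₀ : ∀ w → Spoke w (apex zero , base w)
  spoke-apex₀ w = zero , inj₁ (refl , refl)

  suspend-covers : ∀ p q {w} → suspend p ≈C suspend q → Covers w p → Covers w q
  suspend-covers p q {w} p≈q w∈p
    with w' , w'∈q , s ← ∈E-suspend⁻ q (Equivalence.to (p≈q _) (∈E-suspend⁺ p w∈p (spoke-apex₀ w)))
    rewrite spoke-injective (spoke-apex₀ w) s = w'∈q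

  suspend-injective : ∀ p q → suspend p ≈C suspend q → SameEdge (edge p) (edge q)
  suspend-injective p@(properEdge _ _ u≢v) q p≈q
    with suspend-covers p q p≈q (inj₁ refl) | suspend-covers p q p≈q (inj₂ refl)
  ... | inj₁ u≡ | inj₁ v≡ = ⊥-elim (u≢v (trans u≡ (sym v≡)))
  ... | inj₁ u≡ | inj₂ v≡ = inj₁ (u≡ , v≡)
  ... | inj₂ u≡ | inj₁ v≡ = inj₂ (u≡ , v≡)
  ... | inj₂ u≡ | inj₂ v≡ = ⊥-elim (u≢v (trans u≡ (sym v≡)))

  InUnion-suspend⇔Spoke : (M : List (ProperEdge m)) → (∀ w → Any (Covers w) M) →
                          ∀ e → InUnion e (map suspend M) ⇔ (∃[ w ] Spoke w e)
  InUnion-suspend⇔Spoke M perfect e = mk⇔ to from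
    where
    to : InUnion e (map suspend M) → ∃[ w ] Spoke w e
    to (C , C∈ , e∈C) with p , _ , refl ← ∈-map⁻ suspend C∈ =
      Product.map₂ proj₂ (∈E-suspend⁻ p e∈C)

    from : ∃[ w ] Spoke w e → InUnion e (map suspend M)
    from (w , s) with p , p∈M , w∈p ← find (perfect w) =
      suspend p , ∈-map⁺ suspend p∈M , ∈E-suspend⁺ p w∈p s

  suspend-isMuWayTrade : ∀ {μ s} (T : MatchingTrade μ m s) →
                         IsMuWayTrade μ s (map suspend ∘ MatchingTrade.matching T)
  suspend-isMuWayTrade {μ} {s} T =
    pairwise , volume , disjoint , λ i j i≢j → pairwise i , pairwise j , disjoint i j i≢j , sameUnion i j
    where
    open MatchingTrade T

    pairwise : ∀ i → PairwiseEdgeDisjoint (map suspend (matching i))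
    pairwise i = AllPairs.map⁺ (AllPairs.map (λ {p q} → suspend-edgeDisjoint p q) (vertexDisjoint i))

    volume : ∀ i → length (map suspend (matching i)) ≡ s
    volume i = trans (length-map suspend (matching i)) (size i)

    disjoint : ∀ i j → i ≢ j → DisjointSets (map suspend (matching i)) (map suspend (matching j))
    disjoint i j i≢j C D C∈ D∈ C≈D
      with p , p∈ , refl ← ∈-map⁻ suspend C∈ | q , q∈ , refl ← ∈-map⁻ suspend D∈
      = edgeDisjoint i≢j p∈ q∈ (suspend-injective p q C≈D)

    sameUnion : ∀ i j e → InUnion e (map suspend (matching i)) ⇔ InUnion e (map suspend (matching j))
    sameUnion i j e = ⇔-sym (InUnion-suspend⇔Spoke (matching j) (perfect j) e)
                      ⇔-∘ InUnion-suspend⇔Spoke (matching i) (perfect i) e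

open Suspension using (suspend-isMuWayTrade)

module _ {m n : ℕ} where

  mapProperEdge : (f : Fin m → Fin n) → Injective _≡_ _≡_ f → ProperEdge m → ProperEdge n
  mapProperEdge f f-inj (properEdge u v u≢v) = properEdge (f u) (f v) (u≢v ∘ f-inj)

  module _ {f : Fin m → Fin n} (f-inj : Injective _≡_ _≡_ f) where

    Covers-map⁺ : ∀ p {w} → Covers w p → Covers (f w) (mapProperEdge f f-inj p)
    Covers-map⁺ _ = Sum.map (cong f) (cong f)

    Covers-map⁻ : ∀ p {w} → Covers (f w) (mapProperEdge f f-inj p) → Covers w p
    Covers-map⁻ _ = Sum.map f-inj f-inj

    VertexDisjoint-map : ∀ p q → VertexDisjoint p q →
                         VertexDisjoint (mapProperEdge f f-inj p) (mapProperEdge f f-inj q)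
    VertexDisjoint-map _ q p#q _ (inj₁ refl) fu∈q = p#q _ (inj₁ refl) (Covers-map⁻ q fu∈q)
    VertexDisjoint-map _ q p#q _ (inj₂ refl) fv∈q = p#q _ (inj₂ refl) (Covers-map⁻ q fv∈q)

    SameEdge-map⁻ : ∀ p q →
                    SameEdge (edge (mapProperEdge f f-inj p)) (edge (mapProperEdge f f-inj q)) →
                    SameEdge (edge p) (edge q)
    SameEdge-map⁻ _ _ = Sum.map (Product.map f-inj f-inj) (Product.map f-inj f-inj)

module _ {m m' n : ℕ} {f : Fin m → Fin n} {g : Fin m' → Fin n}
         (f-inj : Injective _≡_ _≡_ f) (g-inj : Injective _≡_ _≡_ g)
         (f#g : ∀ a b → f a ≢ g b) where

  VertexDisjoint-apart : ∀ p q → VertexDisjoint (mapProperEdge f f-inj p) (mapProperEdge g g-inj q)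
  VertexDisjoint-apart _ _ _ (inj₁ refl) = [ f#g _ _ , f#g _ _ ]′
  VertexDisjoint-apart _ _ _ (inj₂ refl) = [ f#g _ _ , f#g _ _ ]′

  ¬SameEdge-apart : ∀ p q →
                    ¬ SameEdge (edge (mapProperEdge f f-inj p)) (edge (mapProperEdge g g-inj q))
  ¬SameEdge-apart _ _ (inj₁ (eq , _)) = f#g _ _ eq
  ¬SameEdge-apart _ _ (inj₂ (eq , _)) = f#g _ _ eq

_⊕_ : ∀ {μ m m' s s'} → MatchingTrade μ m s → MatchingTrade μ m' s' →
      MatchingTrade μ (m + m') (s + s')
_⊕_ {μ} {m} {m'} {s} {s'} T T' = record
  { matching = matching
  ; vertexDisjoint = vertexDisjoint
  ; perfect = λ i w → subst (λ w → Any (Covers w) (matching i)) (join-splitAt m m' w)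
                             (perfect i (splitAt m w))
  ; size = size
  ; edgeDisjoint = edgeDisjoint
  }
  where
  module T = MatchingTrade T
  module T' = MatchingTrade T'

  inl-inj : Injective _≡_ _≡_ (_↑ˡ m')
  inl-inj = ↑ˡ-injective m' _ _

  inr-inj : Injective _≡_ _≡_ (_↑ʳ_ {m'} m)
  inr-inj = ↑ʳ-injective m _ _

  inl : ProperEdge m → ProperEdge (m + m')
  inl = mapProperEdge (_↑ˡ m') inl-inj

  inr : ProperEdge m' → ProperEdge (m + m')
  inr = mapProperEdge (_↑ʳ_ {m'} m) inr-inj

  matching : Fin μ → List (ProperEdge (m + m'))
  matching i = map inl (T.matching i) ++ map inr (T'.matching i)

  vertexDisjoint : ∀ i → AllPairs VertexDisjoint (matching i)
  vertexDisjoint i =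
    AllPairs.++⁺
      (AllPairs.map⁺ (AllPairs.map (λ {p q} → VertexDisjoint-map inl-inj p q) (T.vertexDisjoint i)))
      (AllPairs.map⁺ (AllPairs.map (λ {p q} → VertexDisjoint-map inr-inj p q) (T'.vertexDisjoint i)))
      (All.map⁺ (All.tabulate λ {p} _ → All.map⁺ (All.tabulate λ {q} _ →
        VertexDisjoint-apart inl-inj inr-inj ↑ˡ≢↑ʳ p q)))

  perfect : ∀ i (w : Fin m ⊎ Fin m') → Any (Covers (join m m' w)) (matching i)
  perfect i (inj₁ w) = Any.++⁺ˡ (Any.map⁺ (Any.map (λ {p} → Covers-map⁺ inl-inj p) (T.perfect i w)))
  perfect i (inj₂ w) = Any.++⁺ʳ _ (Any.map⁺ (Any.map (λ {p} → Covers-map⁺ inr-inj p) (T'.perfect i w)))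

  size : ∀ i → length (matching i) ≡ s + s'
  size i = trans (length-++ (map inl (T.matching i)))
                 (cong₂ _+_ (trans (length-map inl (T.matching i)) (T.size i))
                            (trans (length-map inr (T'.matching i)) (T'.size i)))

  edgeDisjoint : ∀ {i j} → i ≢ j → ∀ {p q} → p ∈ matching i → q ∈ matching j →
                 ¬ SameEdge (edge p) (edge q)
  edgeDisjoint {i} {j} i≢j p∈ q∈
    with ∈-++⁻ (map inl (T.matching i)) p∈ | ∈-++⁻ (map inl (T.matching j)) q∈
  ... | inj₁ p∈ˡ | inj₁ q∈ˡ
    with p₀ , p₀∈ , refl ← ∈-map⁻ inl p∈ˡ | q₀ , q₀∈ , refl ← ∈-map⁻ inl q∈ˡ
    = T.edgeDisjoint i≢j p₀∈ q₀∈ ∘ SameEdge-map⁻ inl-inj p₀ q₀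
  ... | inj₂ p∈ʳ | inj₂ q∈ʳ
    with p₀ , p₀∈ , refl ← ∈-map⁻ inr p∈ʳ | q₀ , q₀∈ , refl ← ∈-map⁻ inr q∈ʳ
    = T'.edgeDisjoint i≢j p₀∈ q₀∈ ∘ SameEdge-map⁻ inr-inj p₀ q₀
  ... | inj₁ p∈ˡ | inj₂ q∈ʳ
    with p₀ , _ , refl ← ∈-map⁻ inl p∈ˡ | q₀ , _ , refl ← ∈-map⁻ inr q∈ʳ
    = ¬SameEdge-apart inl-inj inr-inj ↑ˡ≢↑ʳ p₀ q₀
  ... | inj₂ p∈ʳ | inj₁ q∈ˡ
    with p₀ , _ , refl ← ∈-map⁻ inr p∈ʳ | q₀ , _ , refl ← ∈-map⁻ inl q∈ˡ
    = ¬SameEdge-apart inl-inj inr-inj ↑ˡ≢↑ʳ q₀ p₀ ∘ SameEdge-sym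

reindex : ∀ {ν μ m s} (f : Fin ν → Fin μ) → Injective _≡_ _≡_ f →
          MatchingTrade μ m s → MatchingTrade ν m s
reindex f f-inj T = record
  { matching = matching ∘ f
  ; vertexDisjoint = vertexDisjoint ∘ f
  ; perfect = perfect ∘ f
  ; size = size ∘ f
  ; edgeDisjoint = λ i≢j → edgeDisjoint (i≢j ∘ f-inj)
  }
  where open MatchingTrade T

module _ {μ m : ℕ} where

  Certificate : (Fin μ → List (ProperEdge m)) → ℕ → Set
  Certificate M s =
    (∀ i → AllPairs VertexDisjoint (M i)) × (∀ i w → Any (Covers w) (M i)) ×
    (∀ i → length (M i) ≡ s) ×
    (∀ i j → i ≢ j → All (λ p → All (λ q → ¬ SameEdge (edge p) (edge q)) (M j)) (M i))

  certificate? : (M : Fin μ → List (ProperEdge m)) (s : ℕ) → Dec (Certificate M s)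
  certificate? M s =
    all? (λ i → allPairs? vertexDisjoint? (M i)) ×-dec
    all? (λ i → all? λ w → Any.any? (covers? w) (M i)) ×-dec
    all? (λ i → length (M i) ≟ℕ s) ×-dec
    all? (λ i → all? λ j → ¬? (i ≟ j) →-dec
                All.all? (λ p → All.all? (λ q → ¬? (sameEdge? p q)) (M j)) (M i))
    where
    covers? : ∀ w p → Dec (Covers w p)
    covers? w (properEdge u v _) = (w ≟ u) ⊎-dec (w ≟ v)

    vertexDisjoint? : ∀ p q → Dec (VertexDisjoint p q)
    vertexDisjoint? p q = all? λ w → covers? w p →-dec ¬? (covers? w q)

    sameEdge? : ∀ p q → Dec (SameEdge (edge p) (edge q))
    sameEdge? (properEdge u v _) (properEdge u' v' _) =
      ((u ≟ u') ×-dec (v ≟ v')) ⊎-dec ((u ≟ v') ×-dec (v ≟ u'))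

  fromCertificate : ∀ {M s} → Certificate M s → MatchingTrade μ m s
  fromCertificate {M} (vertexDisjoint , perfect , size , edgeDisjoint) = record
    { matching = M
    ; vertexDisjoint = vertexDisjoint
    ; perfect = perfect
    ; size = size
    ; edgeDisjoint = λ i≢j p∈ q∈ → All.lookup (All.lookup (edgeDisjoint _ _ i≢j) p∈) q∈
    }

infix 4 _—_

_—_ : ∀ {m} (u v : Fin m) {u≢v : True (¬? (u ≟ v))} → ProperEdge m
(u — v) {u≢v} = properEdge u v (toWitness u≢v)

K₄-factorisation : MatchingTrade 3 4 2
K₄-factorisation = fromCertificate (toWitness {a? = certificate? M 2} _)
  where
  M : Fin 3 → List (ProperEdge 4)
  M zero             = (# 0 — # 1) ∷ (# 2 — # 3) ∷ []
  M (suc zero)       = (# 0 — # 2) ∷ (# 1 — # 3) ∷ []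
  M (suc (suc zero)) = (# 0 — # 3) ∷ (# 1 — # 2) ∷ []

K₆-matchings : MatchingTrade 3 6 3
K₆-matchings = fromCertificate (toWitness {a? = certificate? M 3} _)
  where
  M : Fin 3 → List (ProperEdge 6)
  M zero             = (# 0 — # 1) ∷ (# 2 — # 3) ∷ (# 4 — # 5) ∷ []
  M (suc zero)       = (# 0 — # 2) ∷ (# 1 — # 4) ∷ (# 3 — # 5) ∷ []
  M (suc (suc zero)) = (# 0 — # 3) ∷ (# 1 — # 5) ∷ (# 2 — # 4) ∷ []

matchingTrade : ∀ k → ∃[ m ] MatchingTrade 3 m (2 + k)
matchingTrade zero          = 4 , K₄-factorisation
matchingTrade (suc zero)    = 6 , K₆-matchings
matchingTrade (suc (suc k)) = Product.map (4 +_) (K₄-factorisation ⊕_) (matchingTrade k)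

existsMuWayTrade : ∀ {μ m s} → MatchingTrade μ m s → ExistsMuWayTrade μ s
existsMuWayTrade {m = m} T = 2 + m , _ , suspend-isMuWayTrade T

mainTheorem5 : (s : ℕ) → 2 ≤ s → ExistsMuWayTrade 3 s × ExistsMuWayTrade 2 s
mainTheorem5 (suc (suc k)) (s≤s (s≤s z≤n)) =
  existsMuWayTrade T , existsMuWayTrade (reindex inject₁ inject₁-injective T)
  where
  T : MatchingTrade 3 _ (2 + k)
  T = proj₂ (matchingTrade k)
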